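{- Let $n\ge 2$. For every composition $c$ of $n$, $\mu(c')=\nu(c)$ and $\nu(c')=\mu(c)$, where $c'$ denotes the conjugate of $c$.
   Context: A composition of $n$ is a finite sequence $(c_1,\ldots,c_k)$ of positive integers with sum $n$. It corresponds bijectively to the subset $\{c_1,\,c_1+c_2,\,\ldots,\,c_1+\cdots+c_{k-1}\}$ of $[n-1]$, and a subset $S\subseteq[n-1]$ corresponds bijectively to the word $w_1\cdots w_{n-1}$ over $\{N,E\}$ with $w_i=N$ if $i\in S$ and $w_i=E$ otherwise. The conjugate $c'$ of $c$ is obtained by passing to this word, interchanging every $N$ with $E$ and every $E$ with $N$, and passing back to a composition of $n$. A part is big if it is $\ge 2$ and small if it equals $1$. Each part has as neighbors the parts immediately before and after it in the sequence (no wraparound), so end parts have one neighbor and the part of a one-part composition has none. Define $\mu(c)$ = sum of the big parts of $c$, and $\nu(c)$ = (sum of the small parts of $c$) + (total number of neighbors of the big parts of $c$). -}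

module Defs where

open import Data.Nat using (ℕ; zero; suc; _+_; _∸_; _≤_; _<_; _≟_)
open import Data.Bool using (Bool; true; false; not; if_then_else_)
open import Data.List using (List; []; _∷_; map)
open import Data.Nat.ListAction using (sum)
open import Data.List.Relation.Unary.All using (All)
open import Data.Product using (_×_)
open import Relation.Nullary.Decidable using (⌊_⌋)
open import Data.List.Membership.DecPropositional _≟_ using (_∈?_)

IsComposition : ℕ → List ℕ → Set
IsComposition n c = All (λ x → 1 ≤ x) c × sum c ≡ n
  where open import Relation.Binary.PropositionalEquality using (_≡_)

N E : Bool
N = true
E = false

partialSums : List ℕ → List ℕ
partialSums [] = []
partialSums (x ∷ []) = []
partialSums (x ∷ y ∷ cs) = x ∷ map (x +_) (partialSums (y ∷ cs))

subsetOf : List ℕ → List ℕ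
subsetOf = partialSums

wordFrom : List ℕ → ℕ → ℕ → List Bool
wordFrom S i zero = []
wordFrom S i (suc k) = ⌊ i ∈? S ⌋ ∷ wordFrom S (suc i) k

wordOfSubset : ℕ → List ℕ → List Bool
wordOfSubset n S = wordFrom S 1 (n ∸ 1)

subsetFrom : ℕ → List Bool → List ℕ
subsetFrom i [] = []
subsetFrom i (b ∷ w) = if b then i ∷ subsetFrom (suc i) w else subsetFrom (suc i) w

subsetOfWord : List Bool → List ℕ
subsetOfWord = subsetFrom 1

compFrom : ℕ → ℕ → List ℕ → List ℕ
compFrom n prev [] = (n ∸ prev) ∷ []
compFrom n prev (s ∷ S) = (s ∸ prev) ∷ compFrom n s S

compOfSubset : ℕ → List ℕ → List ℕ
compOfSubset n S = compFrom n 0 S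

conjugate : ℕ → List ℕ → List ℕ
conjugate n c = compOfSubset n (subsetOfWord (map not (wordOfSubset n (subsetOf c))))

isBig : ℕ → Bool
isBig zero = false
isBig (suc zero) = false
isBig (suc (suc _)) = true

μ : List ℕ → ℕ
μ [] = 0
μ (x ∷ c) = (if isBig x then x else 0) + μ c

-- Number of neighbours of the part in position with given left/right presence.
-- ν(c) = (sum of small parts) + (total number of neighbours of big parts).
-- νAux hasLeft c : contribution of list c, where hasLeft says whether the
-- head of c has a part immediately before it.
νAux : Bool → List ℕ → ℕ
νAux hasLeft [] = 0
νAux hasLeft (x ∷ c) =
  (if isBig x then (left + right c) else (if ⌊ x ≟ 1 ⌋ then x else 0)) + νAux true c
  where
  left : ℕ
  left = if hasLeft then 1 else 0
  right : List ℕ → ℕ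
  right [] = 0
  right (_ ∷ _) = 1

ν : List ℕ → ℕ
ν = νAux false

-- A composition of n is determined by its word w of length n − 1, and reading
-- the parts off w shows that both statistics are word statistics: μ(c) counts
-- the letters E of w plus the maximal runs of E (a run of r letters E makes a
-- big part r + 1), and, when w is nonempty, ν(c) counts the letters N of w
-- plus the maximal runs of N. Conjugation replaces w by its complement, which
-- exchanges the two counts.
module Submission where

open import Defs
open import Data.Empty using (⊥-elim)
open import Data.Nat using (ℕ; zero; suc; _+_; _∸_; _≤_; _<_; _≟_; z≤n; s≤s)
open import Data.Bool using (Bool; true; false; not; if_then_else_; _xor_)
open import Data.List using (List; []; _∷_; _++_; map; replicate; length)
open import Data.List.Properties using (++-identityʳ; length-map)
open import Data.List.Membership.Propositional using (_∈_)
open import Data.List.Membership.Propositional.Properties using (∈-map⁺; ∈-map⁻)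
open import Data.List.Membership.DecPropositional _≟_ using (_∈?_)
open import Data.List.Relation.Unary.All as All using (All; []; _∷_)
open import Data.List.Relation.Unary.All.Properties using (map⁺)
open import Data.List.Relation.Unary.Any using (here; there)
open import Data.Nat.Properties
open import Data.Nat.ListAction using (sum)
open import Data.Product using (_×_; _,_)
open import Function.Bundles using (_⇔_; mk⇔)
open import Relation.Nullary using (¬_)
open import Relation.Nullary.Decidable using (⌊_⌋; isYes≗does; dec-true; dec-false; does-⇔)
open import Relation.Binary.PropositionalEquality

∈?-true : ∀ {i S} → i ∈ S → ⌊ i ∈? S ⌋ ≡ true
∈?-true {i} {S} i∈S = trans (isYes≗does (i ∈? S)) (dec-true (i ∈? S) i∈S)

∈?-false : ∀ {i S} → ¬ i ∈ S → ⌊ i ∈? S ⌋ ≡ false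
∈?-false {i} {S} i∉S = trans (isYes≗does (i ∈? S)) (dec-false (i ∈? S) i∉S)

∈?-cong : ∀ {i j S T} → (i ∈ S ⇔ j ∈ T) → ⌊ i ∈? S ⌋ ≡ ⌊ j ∈? T ⌋
∈?-cong {i} {j} {S} {T} i∈S⇔j∈T = begin
  ⌊ i ∈? S ⌋     ≡⟨ isYes≗does (i ∈? S) ⟩
  _              ≡⟨ does-⇔ i∈S⇔j∈T (i ∈? S) (j ∈? T) ⟩
  _              ≡⟨ isYes≗does (j ∈? T) ⟨
  ⌊ j ∈? T ⌋     ∎
  where open ≡-Reasoning

length-wordFrom : ∀ S i k → length (wordFrom S i k) ≡ k
length-wordFrom S i zero    = refl
length-wordFrom S i (suc k) = cong suc (length-wordFrom S (suc i) k)

wordFrom-++ : ∀ S i p q → wordFrom S i (p + q) ≡ wordFrom S i p ++ wordFrom S (i + p) q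
wordFrom-++ S i zero    q rewrite +-identityʳ i = refl
wordFrom-++ S i (suc p) q rewrite +-suc i p = cong (_ ∷_) (wordFrom-++ S (suc i) p q)

wordFrom-above : ∀ S i k → All (i + k ≤_) S → wordFrom S i k ≡ replicate k false
wordFrom-above S i zero    _     = refl
wordFrom-above S i (suc k) above = cong₂ _∷_
  (∈?-false (λ i∈S → <⇒≱ (m<m+n i (s≤s z≤n)) (All.lookup above i∈S)))
  (wordFrom-above S (suc i) k (All.map (λ {t} → subst (_≤ t) (+-suc i k)) above))

wordFrom-skip : ∀ {s} S {i} k → s < i → wordFrom (s ∷ S) i k ≡ wordFrom S i k
wordFrom-skip S zero    s<i = refl
wordFrom-skip S (suc k) s<i = cong₂ _∷_
  (∈?-cong (mk⇔ (λ { (here refl) → ⊥-elim (<-irrefl refl s<i) ; (there i∈S) → i∈S }) there))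
  (wordFrom-skip S k (m≤n⇒m≤1+n s<i))

wordFrom-shift : ∀ d S i k → wordFrom (map (d +_) S) (d + i) k ≡ wordFrom S i k
wordFrom-shift d S i zero    = refl
wordFrom-shift d S i (suc k) = cong₂ _∷_
  (∈?-cong (mk⇔ unshift (∈-map⁺ (d +_))))
  (trans (cong (λ j → wordFrom (map (d +_) S) j k) (sym (+-suc d i))) (wordFrom-shift d S (suc i) k))
  where
  unshift : d + i ∈ map (d +_) S → i ∈ S
  unshift d+i∈ with ∈-map⁻ (d +_) d+i∈
  ... | j , j∈S , d+i≡d+j = subst (_∈ S) (sym (+-cancelˡ-≡ d i j d+i≡d+j)) j∈S

wordOfComp : List ℕ → List Bool
wordOfComp []           = []
wordOfComp (x ∷ [])     = replicate (x ∸ 1) false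
wordOfComp (x ∷ y ∷ cs) = replicate (x ∸ 1) false ++ true ∷ wordOfComp (y ∷ cs)

wordFrom-partialSums : ∀ c → All (1 ≤_) c → wordFrom (partialSums c) 1 (sum c ∸ 1) ≡ wordOfComp c
wordFrom-partialSums []           _ = refl
wordFrom-partialSums (x ∷ [])     _ rewrite +-identityʳ x = wordFrom-above [] 1 (x ∸ 1) []
wordFrom-partialSums (zero ∷ _ ∷ _)        (() ∷ _)
wordFrom-partialSums (suc x ∷ zero ∷ _)    (_ ∷ () ∷ _)
wordFrom-partialSums (suc x ∷ c@(suc y ∷ cs)) (_ ∷ pos) = begin
  wordFrom S 1 (x + suc m)                      ≡⟨ wordFrom-++ S 1 x (suc m) ⟩
  wordFrom S 1 x ++ wordFrom S (suc x) (suc m)  ≡⟨ cong₂ _++_ (wordFrom-above S 1 x above)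
                                                           (cong₂ _∷_ (∈?-true (here refl)) rest) ⟩
  replicate x false ++ true ∷ wordOfComp c      ∎
  where
  open ≡-Reasoning
  P S : List ℕ
  P = partialSums c
  S = suc x ∷ map (suc x +_) P
  m : ℕ
  m = y + sum cs
  above : All (suc x ≤_) S
  above = ≤-refl ∷ map⁺ (All.universal (m≤m+n (suc x)) P)
  rest : wordFrom S (suc (suc x)) m ≡ wordOfComp c
  rest = begin
    wordFrom S (suc (suc x)) m                   ≡⟨ wordFrom-skip _ m ≤-refl ⟩
    wordFrom (map (suc x +_) P) (suc (suc x)) m  ≡⟨ cong (λ j → wordFrom (map (suc x +_) P) j m) (+-comm 1 (suc x)) ⟩
    wordFrom (map (suc x +_) P) (suc x + 1) m    ≡⟨ wordFrom-shift (suc x) P 1 m ⟩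
    wordFrom P 1 m                               ≡⟨ wordFrom-partialSums c pos ⟩
    wordOfComp c                                 ∎

wordOfSubset-subsetOf : ∀ {n c} → IsComposition n c → wordOfSubset n (subsetOf c) ≡ wordOfComp c
wordOfSubset-subsetOf (pos , refl) = wordFrom-partialSums _ pos

-- k is the size of the part being read, which each letter N closes.
compOfWordFrom : ℕ → List Bool → List ℕ
compOfWordFrom k []          = k ∷ []
compOfWordFrom k (false ∷ w) = compOfWordFrom (suc k) w
compOfWordFrom k (true ∷ w)  = k ∷ compOfWordFrom 1 w

compOfWord : List Bool → List ℕ
compOfWord = compOfWordFrom 1

compOfWordFrom-replicate : ∀ k m w → compOfWordFrom k (replicate m false ++ w) ≡ compOfWordFrom (k + m) w
compOfWordFrom-replicate k zero    w rewrite +-identityʳ k = refl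
compOfWordFrom-replicate k (suc m) w rewrite +-suc k m = compOfWordFrom-replicate (suc k) m w

compOfWord-wordOfComp : ∀ x cs → All (1 ≤_) (x ∷ cs) → compOfWord (wordOfComp (x ∷ cs)) ≡ x ∷ cs
compOfWord-wordOfComp x [] (1≤x ∷ []) = begin
  compOfWord (replicate (x ∸ 1) false)        ≡⟨ cong compOfWord (++-identityʳ (replicate (x ∸ 1) false)) ⟨
  compOfWord (replicate (x ∸ 1) false ++ [])  ≡⟨ compOfWordFrom-replicate 1 (x ∸ 1) [] ⟩
  (1 + (x ∸ 1)) ∷ []                          ≡⟨ cong (_∷ []) (m+[n∸m]≡n 1≤x) ⟩
  x ∷ []                                      ∎
  where open ≡-Reasoning
compOfWord-wordOfComp x (y ∷ cs) (1≤x ∷ pos) = begin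
  compOfWord (replicate (x ∸ 1) false ++ true ∷ wordOfComp (y ∷ cs)) ≡⟨ compOfWordFrom-replicate 1 (x ∸ 1) _ ⟩
  (1 + (x ∸ 1)) ∷ compOfWord (wordOfComp (y ∷ cs))                  ≡⟨ cong₂ _∷_ (m+[n∸m]≡n 1≤x) (compOfWord-wordOfComp y cs pos) ⟩
  x ∷ y ∷ cs                                                       ∎
  where open ≡-Reasoning

compFrom-subsetFrom : ∀ i prev w → prev ≤ i →
  compFrom (i + length w) prev (subsetFrom i w) ≡ compOfWordFrom (i ∸ prev) w
compFrom-subsetFrom i prev []          prev≤i rewrite +-identityʳ i = refl
compFrom-subsetFrom i prev (false ∷ w) prev≤i rewrite +-suc i (length w) = begin
  compFrom (suc i + length w) prev (subsetFrom (suc i) w) ≡⟨ compFrom-subsetFrom (suc i) prev w (m≤n⇒m≤1+n prev≤i) ⟩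
  compOfWordFrom (suc i ∸ prev) w                          ≡⟨ cong (λ k → compOfWordFrom k w) (+-∸-assoc 1 prev≤i) ⟩
  compOfWordFrom (suc (i ∸ prev)) w                        ∎
  where open ≡-Reasoning
compFrom-subsetFrom i prev (true ∷ w)  prev≤i rewrite +-suc i (length w) = cong ((i ∸ prev) ∷_) (begin
  compFrom (suc i + length w) i (subsetFrom (suc i) w) ≡⟨ compFrom-subsetFrom (suc i) i w (n≤1+n i) ⟩
  compOfWordFrom (suc i ∸ i) w                          ≡⟨ cong (λ k → compOfWordFrom k w) (m+n∸n≡m 1 i) ⟩
  compOfWord w                                          ∎)
  where open ≡-Reasoning

compOfSubset-subsetOfWord : ∀ w → compOfSubset (suc (length w)) (subsetOfWord w) ≡ compOfWord w
compOfSubset-subsetOfWord w = compFrom-subsetFrom 1 0 w z≤n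

conjugate≡compOfWord : ∀ m c → conjugate (suc m) c ≡ compOfWord (map not (wordOfSubset (suc m) (subsetOf c)))
conjugate≡compOfWord m c =
  subst (λ k → compOfSubset (suc k) (subsetOfWord w) ≡ compOfWord w) length-w (compOfSubset-subsetOfWord w)
  where
  w : List Bool
  w = map not (wordOfSubset (suc m) (subsetOf c))
  length-w : length w ≡ m
  length-w = trans (length-map not (wordFrom (subsetOf c) 1 m)) (length-wordFrom (subsetOf c) 1 m)

𝟙 : Bool → ℕ
𝟙 b = if b then 1 else 0

-- runWeight t p w counts the letters t of w plus the maximal runs of t that end
-- within w or at its end; p records whether the letter before w was a t.
runWeight : Bool → Bool → List Bool → ℕ
runWeight t p []      = 𝟙 p
runWeight t p (b ∷ w) = if b xor t then 𝟙 p + runWeight t false w else suc (runWeight t true w)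

runWeight-map-not : ∀ t p w → runWeight t p (map not w) ≡ runWeight (not t) p w
runWeight-map-not t     p []          = refl
runWeight-map-not true  p (true ∷ w)  = cong (𝟙 p +_) (runWeight-map-not true false w)
runWeight-map-not true  p (false ∷ w) = cong suc (runWeight-map-not true true w)
runWeight-map-not false p (true ∷ w)  = cong suc (runWeight-map-not false true w)
runWeight-map-not false p (false ∷ w) = cong (𝟙 p +_) (runWeight-map-not false false w)

μ-compOfWordFrom : ∀ k w → μ (compOfWordFrom (2 + k) w) ≡ suc k + runWeight false true w
μ-compOfWord : ∀ w → μ (compOfWord w) ≡ runWeight false false w
μ-compOfWordFrom k []          = trans (+-identityʳ (2 + k)) (+-comm 1 (suc k))
μ-compOfWordFrom k (false ∷ w) = trans (μ-compOfWordFrom (suc k) w) (sym (+-suc (suc k) _))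
μ-compOfWordFrom k (true ∷ w)  = trans (cong (2 + k +_) (μ-compOfWord w)) (sym (+-suc (suc k) _))
μ-compOfWord []          = refl
μ-compOfWord (false ∷ w) = μ-compOfWordFrom 0 w
μ-compOfWord (true ∷ w)  = μ-compOfWord w

-- The contribution to ν of a part x that has a right neighbour, and a left one iff L.
νPart : Bool → ℕ → ℕ
νPart L x = if isBig x then 𝟙 L + 1 else (if ⌊ x ≟ 1 ⌋ then x else 0)

νAux-∷-compOfWordFrom : ∀ L x k w → νAux L (x ∷ compOfWordFrom k w) ≡ νPart L x + νAux true (compOfWordFrom k w)
νAux-∷-compOfWordFrom L x k []          = refl
νAux-∷-compOfWordFrom L x k (false ∷ w) = νAux-∷-compOfWordFrom L x (suc k) w
νAux-∷-compOfWordFrom L x k (true ∷ w)  = refl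

νAux-compOfWordFrom : ∀ L k w → νAux L (compOfWordFrom (2 + k) w) ≡ 𝟙 L + runWeight true false w
νAux-compOfWord : ∀ w → νAux true (compOfWord w) ≡ runWeight true true w
νAux-compOfWordFrom L k []          = +-identityʳ (𝟙 L + 0)
νAux-compOfWordFrom L k (false ∷ w) = νAux-compOfWordFrom L (suc k) w
νAux-compOfWordFrom L k (true ∷ w)  = begin
  νAux L (2 + k ∷ compOfWord w)               ≡⟨ νAux-∷-compOfWordFrom L (2 + k) 1 w ⟩
  (𝟙 L + 1) + νAux true (compOfWord w)         ≡⟨ cong (𝟙 L + 1 +_) (νAux-compOfWord w) ⟩
  (𝟙 L + 1) + runWeight true true w            ≡⟨ +-assoc (𝟙 L) 1 _ ⟩
  𝟙 L + suc (runWeight true true w)            ∎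
  where open ≡-Reasoning
νAux-compOfWord []          = refl
νAux-compOfWord (false ∷ w) = νAux-compOfWordFrom true 0 w
νAux-compOfWord (true ∷ w)  = trans (νAux-∷-compOfWordFrom true 1 1 w) (cong suc (νAux-compOfWord w))

-- Fails for w = []: its only part 1 is small, so ν = 1 while runWeight true false [] = 0.
ν-compOfWord : ∀ w → w ≢ [] → ν (compOfWord w) ≡ runWeight true false w
ν-compOfWord []          w≢[] = ⊥-elim (w≢[] refl)
ν-compOfWord (false ∷ w) _    = νAux-compOfWordFrom false 0 w
ν-compOfWord (true ∷ w)  _    = trans (νAux-∷-compOfWordFrom false 1 1 w) (cong suc (νAux-compOfWord w))

compOfWord-wordOfSubset : ∀ {n c} → 1 ≤ n → IsComposition n c → compOfWord (wordOfSubset n (subsetOf c)) ≡ c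
compOfWord-wordOfSubset {c = []}     ()  (_ , refl)
compOfWord-wordOfSubset {c = x ∷ cs} 1≤n isComp@(pos , _) =
  trans (cong compOfWord (wordOfSubset-subsetOf isComp)) (compOfWord-wordOfComp x cs pos)

theorem3 : (n : ℕ) → 2 ≤ n → (c : List ℕ) → IsComposition n c →
    (μ (conjugate n c) ≡ ν c) × (ν (conjugate n c) ≡ μ c)
theorem3 n@(suc (suc m)) (s≤s (s≤s _)) c isComp = μ-conjugate , ν-conjugate
  where
  open ≡-Reasoning
  w : List Bool
  w = wordOfSubset n (subsetOf c)
  compOfWord-w : compOfWord w ≡ c
  compOfWord-w = compOfWord-wordOfSubset (s≤s z≤n) isComp
  μ-conjugate : μ (conjugate n c) ≡ ν c
  μ-conjugate = begin
    μ (conjugate n c)                 ≡⟨ cong μ (conjugate≡compOfWord (suc m) c) ⟩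
    μ (compOfWord (map not w))        ≡⟨ μ-compOfWord (map not w) ⟩
    runWeight false false (map not w) ≡⟨ runWeight-map-not false false w ⟩
    runWeight true false w            ≡⟨ ν-compOfWord w (λ ()) ⟨
    ν (compOfWord w)                  ≡⟨ cong ν compOfWord-w ⟩
    ν c                               ∎
  ν-conjugate : ν (conjugate n c) ≡ μ c
  ν-conjugate = begin
    ν (conjugate n c)                 ≡⟨ cong ν (conjugate≡compOfWord (suc m) c) ⟩
    ν (compOfWord (map not w))        ≡⟨ ν-compOfWord (map not w) (λ ()) ⟩
    runWeight true false (map not w)  ≡⟨ runWeight-map-not true false w ⟩
    runWeight false false w           ≡⟨ μ-compOfWord w ⟨
    μ (compOfWord w)                  ≡⟨ cong μ compOfWord-w ⟩
    μ c                               ∎
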